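{- Let $F$ be a field and $G$ a subfield of $F$. Then $N_{n}(G)\geq N_{n}(F)$ for all positive integers $n$.
   Context: For a ring $R$, let $S(R):=\{a^{2} : a\in R\}$ denote the set of squares in $R$. For a subset $A\subseteq R$, the sumset is $A+A:=\{a+b : a,b\in A\}$. For a positive integer $n$, define $N_{n}(R):=\inf\{\,|A+A| : A\subseteq S(R),\ |A|=n\,\}$. -}

module Defs where

open import Level using (Level; _⊔_) renaming (suc to lsuc)
open import Data.Nat using (ℕ)
open import Data.Fin using (Fin)
open import Data.Product using (Σ; ∃; _,_; proj₁; proj₂)
open import Relation.Nullary using (¬_)
open import Algebra.Bundles using (CommutativeRing)
open import Algebra.Bundles.Raw using (RawRing)

record Field (c ℓ : Level) : Set (lsuc (c ⊔ ℓ)) where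
  field
    commutativeRing : CommutativeRing c ℓ
  open CommutativeRing commutativeRing public
  field
    0≉1     : ¬ (0# ≈ 1#)
    inverse : ∀ x → ¬ (x ≈ 0#) → ∃ λ y → (x * y) ≈ 1#

record IsSubfield {c ℓ p : Level} (F : Field c ℓ) (P : Field.Carrier F → Set p)
       : Set (c ⊔ ℓ ⊔ p) where
  open Field F
  field
    resp  : ∀ {x y} → x ≈ y → P x → P y
    0∈    : P 0#
    1∈    : P 1#
    +-closed : ∀ {x y} → P x → P y → P (x + y)
    neg-closed : ∀ {x} → P x → P (- x)
    *-closed : ∀ {x y} → P x → P y → P (x * y)
    inv-closed : ∀ {x y} → P x → ¬ (x ≈ 0#) → (x * y) ≈ 1# → P y

fieldRawRing : ∀ {c ℓ} → Field c ℓ → RawRing c ℓ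
fieldRawRing F = CommutativeRing.rawRing (Field.commutativeRing F)

subRawRing : ∀ {c ℓ p} (F : Field c ℓ) {P : Field.Carrier F → Set p} →
             IsSubfield F P → RawRing (c ⊔ p) ℓ
subRawRing F {P} sub = record
  { Carrier = Σ Carrier P
  ; _≈_ = λ x y → proj₁ x ≈ proj₁ y
  ; _+_ = λ x y → (proj₁ x + proj₁ y) , +-closed (proj₂ x) (proj₂ y)
  ; _*_ = λ x y → (proj₁ x * proj₁ y) , *-closed (proj₂ x) (proj₂ y)
  ; -_  = λ x → (- proj₁ x) , neg-closed (proj₂ x)
  ; 0#  = 0# , 0∈
  ; 1#  = 1# , 1∈
  }
  where
  open Field F
  open IsSubfield sub

module _ {c ℓ : Level} (R : RawRing c ℓ) where
  open RawRing R

  -- An n-element subset A of R, listed without repetition: a ↦ Fin n → R injective.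
  Injective : ∀ {n} → (Fin n → Carrier) → Set ℓ
  Injective a = ∀ {i j} → a i ≈ a j → i ≡F j
    where open import Relation.Binary.PropositionalEquality renaming (_≡_ to _≡F_)

  AllSquares : ∀ {n} → (Fin n → Carrier) → Set (c ⊔ ℓ)
  AllSquares a = ∀ i → ∃ λ r → a i ≈ (r * r)

  -- |A + A| ≤ m: the sumset A + A = {a + b | a, b ∈ A} is contained in
  -- a set of (at most) m elements e 0, …, e (m-1).
  SumsetCard≤ : ∀ {n} → (Fin n → Carrier) → ℕ → Set (c ⊔ ℓ)
  SumsetCard≤ {n} a m =
    Σ (Fin m → Carrier) λ e → ∀ i j → ∃ λ k → (a i + a j) ≈ e k

  -- N_n(R) ≤ m, where N_n(R) = inf { |A + A| : A ⊆ S(R), |A| = n } ∈ ℕ ∪ {∞}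
  -- (inf ∅ = ∞). Since the infimum of a nonempty set of naturals is attained,
  -- N_n(R) ≤ m holds iff some admissible A has |A + A| ≤ m.
  N≤ : ℕ → ℕ → Set (c ⊔ ℓ)
  N≤ n m = Σ (Fin n → Carrier) λ a →
             Σ (Injective a) λ _ → Σ (AllSquares a) λ _ → SumsetCard≤ a m

module Submission where

open import Defs
open import Level using (Level)
open import Data.Nat using (ℕ; _≥_)
open import Data.Product using (_,_; proj₁)
open import Algebra.Bundles using (Ring)
open import Algebra.Bundles.Raw using (RawRing)
open import Algebra.Morphism.Structures using (module RingMorphisms)

module _ {a b ℓ₁ ℓ₂} {R : RawRing a ℓ₁} {S : Ring b ℓ₂}
         {f : RawRing.Carrier R → Ring.Carrier S}
         (mono : RingMorphisms.IsRingMonomorphism R (Ring.rawRing S) f) where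

  open Ring S using (trans; sym)
  open RingMorphisms.IsRingMonomorphism mono using (injective; ⟦⟧-cong; +-homo; *-homo)

  N≤-monomorphism : ∀ {n m} → N≤ R n m → N≤ (Ring.rawRing S) n m
  N≤-monomorphism (x , x-injective , x-squares , e , e-covers) =
    (λ i → f (x i)) ,
    (λ fxᵢ≈fxⱼ → x-injective (injective fxᵢ≈fxⱼ)) ,
    (λ i → let (r , xᵢ≈r²) = x-squares i in
           f r , trans (⟦⟧-cong xᵢ≈r²) (*-homo r r)) ,
    (λ k → f (e k)) ,
    (λ i j → let (k , xᵢ+xⱼ≈eₖ) = e-covers i j in
             k , trans (sym (+-homo (x i) (x j))) (⟦⟧-cong xᵢ+xⱼ≈eₖ))

module _ {c ℓ p} (F : Field c ℓ) {P : Field.Carrier F → Set p} (G : IsSubfield F P) where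

  open Field F using (ring; refl)

  subfield-inclusion-isRingMonomorphism :
    RingMorphisms.IsRingMonomorphism (subRawRing F G) (Ring.rawRing ring) proj₁
  subfield-inclusion-isRingMonomorphism = record
    { isRingHomomorphism = record
      { isSemiringHomomorphism = record
        { isNearSemiringHomomorphism = record
          { +-isMonoidHomomorphism = record
            { isMagmaHomomorphism = record
              { isRelHomomorphism = record { cong = λ x≈y → x≈y }
              ; homo = λ _ _ → refl
              }
            ; ε-homo = refl
            }
          ; *-homo = λ _ _ → refl
          }
        ; 1#-homo = refl
        }
      ; -‿homo = λ _ → refl
      }
    ; injective = λ x≈y → x≈y
    }

-- The transfer works for every n.
mainTheorem2 : ∀ {c ℓ p : Level} (F : Field c ℓ) (P : Field.Carrier F → Set p)
    (G : IsSubfield F P) (n : ℕ) → n ≥ 1 →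
    ∀ m → N≤ (subRawRing F G) n m → N≤ (fieldRawRing F) n m
mainTheorem2 F P G n _ m = N≤-monomorphism {S = Field.ring F} (subfield-inclusion-isRingMonomorphism F G)
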